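{- A family $\mathcal{F}\subseteq 2^{[n]}$ is s-extremal if and only if there exists a Sperner family $\mathcal{S}\subseteq 2^{[n]}$ such that $\mathcal{F}$ is $\mathcal{S}$-extremal.
   Context: $[n]=\{1,\dots,n\}$. A family $\mathcal{F}\subseteq 2^{[n]}$ shatters $S\subseteq[n]$ if $\{F\cap S: F\in\mathcal{F}\}=2^S$; $\mathrm{Sh}(\mathcal{F})$ is the family of sets shattered by $\mathcal{F}$. $\mathcal{F}$ is s-extremal if $|\mathrm{Sh}(\mathcal{F})|=|\mathcal{F}|$. A Sperner family is a family none of whose members contains another. For a Sperner family $\mathcal{S}$, let $\mathcal{H}(\mathcal{S})$ be the family of all subsets of $[n]$ that contain no member of $\mathcal{S}$. A family $\mathcal{F}\subseteq 2^{[n]}$ is called $\mathcal{S}$-extremal if $\mathcal{F}$ shatters no element of $\mathcal{S}$ and $|\mathcal{F}|=|\mathcal{H}(\mathcal{S})|$. -}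

module Defs where

open import Data.Nat using (ℕ; zero; suc)
open import Data.Bool using (Bool; true; false; not; _∧_; _∨_)
import Data.Bool as B
open import Data.List using (List; []; _∷_; _++_; map; filter; length)
open import Data.Bool.ListAction using (all; any)
open import Data.Vec using (Vec; []; _∷_)
open import Data.Fin.Subset using (Subset; _⊆_; _∩_; inside; outside)
open import Data.Fin.Subset.Properties using (_⊆?_)
open import Data.Vec.Properties using (≡-dec)
open import Data.Product using (Σ; _×_)
open import Relation.Nullary.Decidable using (⌊_⌋)
open import Relation.Binary.PropositionalEquality using (_≡_)

-- Subsets of [n] are 'Subset n' (characteristic vectors, Vec Bool n).
-- A family F ⊆ 2^[n] is given by its characteristic function.
Family : ℕ → Set
Family n = Subset n → Bool

-- list of all 2^n subsets of [n] (each exactly once)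
allSubsets : (n : ℕ) → List (Subset n)
allSubsets zero = [] ∷ []
allSubsets (suc n) = map (outside ∷_) (allSubsets n) ++ map (inside ∷_) (allSubsets n)

∣_∣ᶠ : {n : ℕ} → Family n → ℕ
∣_∣ᶠ {n} F = length (filter (λ A → F A B.≟ true) (allSubsets n))

_⊆ᵇ_ : {n : ℕ} → Subset n → Subset n → Bool
A ⊆ᵇ B = ⌊ A ⊆? B ⌋

_==ᵇ_ : {n : ℕ} → Subset n → Subset n → Bool
A ==ᵇ B = ⌊ ≡-dec B._≟_ A B ⌋

-- F shatters S : {A ∩ S : A ∈ F} = 2^S, i.e. every T ⊆ S is a trace A ∩ S
-- of some A ∈ F (traces are automatically subsets of S).
shatters : {n : ℕ} → Family n → Subset n → Bool
shatters {n} F S =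
  all (λ T → not (T ⊆ᵇ S) ∨ any (λ A → F A ∧ ((A ∩ S) ==ᵇ T)) (allSubsets n))
      (allSubsets n)

Sh : {n : ℕ} → Family n → Family n
Sh F S = shatters F S

SExtremal : {n : ℕ} → Family n → Set
SExtremal F = ∣ Sh F ∣ᶠ ≡ ∣ F ∣ᶠ

Sperner : {n : ℕ} → Family n → Set
Sperner S = ∀ A B → S A ≡ true → S B ≡ true → A ⊆ B → A ≡ B

H : {n : ℕ} → Family n → Family n
H {n} S X = not (any (λ A → S A ∧ (A ⊆ᵇ X)) (allSubsets n))

_-Extremal_ : {n : ℕ} → Family n → Family n → Set
S -Extremal F = (∀ A → S A ≡ true → shatters F A ≡ false) × (∣ F ∣ᶠ ≡ ∣ H S ∣ᶠ)

module Submission where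

-- Two general facts carry the proof.
--  * Pajor's lemma: |F| ≤ |Sh(F)|, by induction on n, splitting F along the
--    first coordinate into F₀, F₁ and comparing with F₀ ∪ F₁ and F₀ ∩ F₁.
--  * Sh(F) is closed under taking subsets, and every down-closed family D
--    equals H(S) where S is the family of minimal sets outside D; such an S
--    is always a Sperner family.
-- (⇒) Take S = the minimal non-shattered sets. F shatters no member of S and
--     |H(S)| = |Sh(F)| = |F|.
-- (⇐) If F shatters no member of S, then by down-closure every shattered set
--     avoids S, so |Sh(F)| ≤ |H(S)| = |F| ≤ |Sh(F)| by Pajor's lemma.

open import Defs
open import Data.Nat using (ℕ; zero; suc; _+_; _≤_; _<_; z≤n; s≤s)
import Data.Nat.Properties as ℕ
open import Data.Nat.Induction using (<-wellFounded)
open import Data.Product using (Σ; _×_; _,_; proj₁; proj₂; ∃-syntax)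
open import Data.Bool using (Bool; true; false; not; _∧_; _∨_; if_then_else_; T)
import Data.Bool as Bool
open import Data.Bool.Properties using (T-≡; T-not-≡; T-∧; ∧-identityʳ)
open import Data.Bool.ListAction using (any)
open import Data.Unit using (tt)
open import Data.Empty using (⊥-elim)
open import Data.List using (List; []; _∷_; _++_; map; filter; length)
open import Data.List.Membership.Propositional using (_∈_; lose)
open import Data.List.Membership.Propositional.Properties using (∈-map⁺; ∈-++⁺ˡ; ∈-++⁺ʳ)
open import Data.List.Relation.Unary.Any using (here; satisfied)
open import Data.List.Relation.Unary.Any.Properties using (any⁺; any⁻)
import Data.List.Relation.Unary.All as All
open import Data.List.Relation.Unary.All.Properties using (all⁺; all⁻)
open import Data.Vec using ([]; _∷_)
import Data.Vec.Base as Vec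
open import Data.Vec.Properties using (≡-dec)
open import Data.Fin.Subset using (Subset; _⊆_; _∩_; inside; outside; ∣_∣)
open import Data.Fin.Subset.Properties
  using (_⊆?_; ⊆-refl; ⊆-trans; ⊆-antisym; drop-∷-⊆; p⊆q⇒∣p∣≤∣q∣; p∩q⊆p; x∈p∩q⁺; ∩-assoc; ∩-comm)
open import Function using (_on_)
open import Function.Bundles using (_⇔_; mk⇔; Equivalence)
open import Induction.WellFounded using (Acc; acc)
open import Relation.Binary.Construct.On using (wellFounded)
open import Relation.Nullary using (¬_; yes; no; contradiction)
open import Relation.Nullary.Decidable using (toWitness; fromWitness; toWitnessFalse; fromWitnessFalse)
open import Relation.Binary.PropositionalEquality

open Equivalence using (to; from)

T-not-¬ : ∀ {b} → T (not b) → ¬ T b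
T-not-¬ {true} () _

count : {A : Set} → (A → Bool) → List A → ℕ
count p [] = 0
count p (x ∷ xs) = if p x then suc (count p xs) else count p xs

count-++ : {A : Set} (p : A → Bool) (xs ys : List A) →
  count p (xs ++ ys) ≡ count p xs + count p ys
count-++ p [] ys = refl
count-++ p (x ∷ xs) ys with p x
... | true = cong suc (count-++ p xs ys)
... | false = count-++ p xs ys

count-map : {A C : Set} (p : C → Bool) (f : A → C) (xs : List A) →
  count p (map f xs) ≡ count (λ x → p (f x)) xs
count-map p f [] = refl
count-map p f (x ∷ xs) with p (f x)
... | true = cong suc (count-map p f xs)
... | false = count-map p f xs

count-mono : {A : Set} (p q : A → Bool) → (∀ x → T (p x) → T (q x)) →
  (xs : List A) → count p xs ≤ count q xs
count-mono p q p⇒q [] = z≤n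
count-mono p q p⇒q (x ∷ xs) with p x in px | q x in qx
... | true | true = s≤s (count-mono p q p⇒q xs)
... | true | false = ⊥-elim (subst T qx (p⇒q x (subst T (sym px) tt)))
... | false | true = ℕ.m≤n⇒m≤1+n (count-mono p q p⇒q xs)
... | false | false = count-mono p q p⇒q xs

count-∨-∧ : {A : Set} (p q : A → Bool) (xs : List A) →
  count (λ x → p x ∨ q x) xs + count (λ x → p x ∧ q x) xs ≡ count p xs + count q xs
count-∨-∧ p q [] = refl
count-∨-∧ p q (x ∷ xs) with p x | q x | count-∨-∧ p q xs
... | true | true | ih = cong suc (begin
  count (λ x → p x ∨ q x) xs + suc (count (λ x → p x ∧ q x) xs)
    ≡⟨ ℕ.+-suc _ _ ⟩
  suc (count (λ x → p x ∨ q x) xs + count (λ x → p x ∧ q x) xs)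
    ≡⟨ cong suc ih ⟩
  suc (count p xs + count q xs)
    ≡⟨ ℕ.+-suc _ _ ⟨
  count p xs + suc (count q xs) ∎)
  where open ≡-Reasoning
... | true | false | ih = cong suc ih
... | false | true | ih = trans (cong suc ih) (sym (ℕ.+-suc _ _))
... | false | false | ih = ih

∣∣ᶠ-count : ∀ {n} (F : Family n) → ∣ F ∣ᶠ ≡ count F (allSubsets n)
∣∣ᶠ-count {n} F = go (allSubsets n)
  where
  go : ∀ xs → length (filter (λ A → F A Bool.≟ true) xs) ≡ count F xs
  go [] = refl
  go (x ∷ xs) with F x
  ... | true = cong suc (go xs)
  ... | false = go xs

∣∣ᶠ-mono : ∀ {n} (F G : Family n) → (∀ X → T (F X) → T (G X)) → ∣ F ∣ᶠ ≤ ∣ G ∣ᶠ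
∣∣ᶠ-mono {n} F G F⊆G = begin
  ∣ F ∣ᶠ                  ≡⟨ ∣∣ᶠ-count F ⟩
  count F (allSubsets n)  ≤⟨ count-mono F G F⊆G (allSubsets n) ⟩
  count G (allSubsets n)  ≡⟨ ∣∣ᶠ-count G ⟨
  ∣ G ∣ᶠ                  ∎
  where open ℕ.≤-Reasoning

∣∣ᶠ-cong : ∀ {n} (F G : Family n) → (∀ X → T (F X) ⇔ T (G X)) → ∣ F ∣ᶠ ≡ ∣ G ∣ᶠ
∣∣ᶠ-cong F G F⇔G =
  ℕ.≤-antisym (∣∣ᶠ-mono F G (λ X → to (F⇔G X))) (∣∣ᶠ-mono G F (λ X → from (F⇔G X)))

count-allSubsets-suc : ∀ {n} (F : Family (suc n)) →
  count F (allSubsets (suc n)) ≡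
  count (λ A → F (outside ∷ A)) (allSubsets n) + count (λ A → F (inside ∷ A)) (allSubsets n)
count-allSubsets-suc {n} F =
  trans (count-++ F (map (outside ∷_) (allSubsets n)) _)
        (cong₂ _+_ (count-map F (outside ∷_) (allSubsets n)) (count-map F (inside ∷_) (allSubsets n)))

allSubsets-complete : ∀ {n} (A : Subset n) → A ∈ allSubsets n
allSubsets-complete [] = here refl
allSubsets-complete {suc n} (outside ∷ A) = ∈-++⁺ˡ (∈-map⁺ (outside ∷_) (allSubsets-complete A))
allSubsets-complete {suc n} (inside ∷ A) =
  ∈-++⁺ʳ (map (outside ∷_) (allSubsets n)) (∈-map⁺ (inside ∷_) (allSubsets-complete A))

none-intro : ∀ {n} (p : Subset n → Bool) → (∀ A → ¬ T (p A)) → T (not (any p (allSubsets n)))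
none-intro {n} p none with any p (allSubsets n) in e
... | false = tt
... | true = let A , pA = satisfied (any⁻ p (allSubsets n) (subst T (sym e) tt)) in none A pA

none-elim : ∀ {n} (p : Subset n → Bool) → T (not (any p (allSubsets n))) → ∀ A → ¬ T (p A)
none-elim p none A pA = T-not-¬ none (any⁺ p (lose (allSubsets-complete A) pA))

⊆⇒∩≡ : ∀ {n} {p q : Subset n} → p ⊆ q → p ∩ q ≡ p
⊆⇒∩≡ {p = p} {q} p⊆q = ⊆-antisym (p∩q⊆p p q) (λ x∈p → x∈p∩q⁺ (x∈p , p⊆q x∈p))

⊆-∣∣-≡ : ∀ {n} {p q : Subset n} → p ⊆ q → ∣ p ∣ ≡ ∣ q ∣ → p ≡ q
⊆-∣∣-≡ {p = []} {[]} _ _ = refl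
⊆-∣∣-≡ {p = outside ∷ p} {outside ∷ q} p⊆q e = cong (outside ∷_) (⊆-∣∣-≡ (drop-∷-⊆ p⊆q) e)
⊆-∣∣-≡ {p = inside ∷ p} {inside ∷ q} p⊆q e =
  cong (inside ∷_) (⊆-∣∣-≡ (drop-∷-⊆ p⊆q) (ℕ.suc-injective e))
⊆-∣∣-≡ {p = inside ∷ p} {outside ∷ q} p⊆q e with p⊆q Vec.here
... | ()
⊆-∣∣-≡ {p = outside ∷ p} {inside ∷ q} p⊆q e =
  contradiction e (ℕ.<⇒≢ (s≤s (p⊆q⇒∣p∣≤∣q∣ (drop-∷-⊆ p⊆q))))

⊊⇒∣∣< : ∀ {n} {p q : Subset n} → p ⊆ q → p ≢ q → ∣ p ∣ < ∣ q ∣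
⊊⇒∣∣< p⊆q p≢q = ℕ.≤∧≢⇒< (p⊆q⇒∣p∣≤∣q∣ p⊆q) (λ e → p≢q (⊆-∣∣-≡ p⊆q e))

Shatters : ∀ {n} → Family n → Subset n → Set
Shatters {n} F S = ∀ R → R ⊆ S → ∃[ A ] (T (F A) × A ∩ S ≡ R)

shatters-sound : ∀ {n} (F : Family n) S → T (shatters F S) → Shatters F S
shatters-sound {n} F S sh R R⊆S
  with R ⊆? S | All.lookup (all⁺ _ (allSubsets n) sh) (allSubsets-complete R)
... | no R⊈S | _ = ⊥-elim (R⊈S R⊆S)
... | yes _ | trace-found =
  let A , FA∧trace = satisfied (any⁻ _ (allSubsets n) trace-found)
      FA , trace = to T-∧ FA∧trace
  in A , FA , toWitness trace

shatters-complete : ∀ {n} (F : Family n) S → Shatters F S → T (shatters F S)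
shatters-complete {n} F S sh = all⁻ _ {allSubsets n} (All.tabulate λ {R} _ → trace-found R)
  where
  trace-found : ∀ R → T (not (R ⊆ᵇ S) ∨ any (λ A → F A ∧ ((A ∩ S) ==ᵇ R)) (allSubsets n))
  trace-found R with R ⊆? S
  ... | no _ = tt
  ... | yes R⊆S =
    let A , FA , trace = sh R R⊆S
    in any⁺ _ (lose (allSubsets-complete A) (from T-∧ (FA , fromWitness trace)))

-- Shattered sets are closed under subsets: traces on X restrict to A ⊆ X.
shatters-downward : ∀ {n} (F : Family n) {X A} → A ⊆ X → Shatters F X → Shatters F A
shatters-downward F {X} {A} A⊆X shX R R⊆A =
  let B , FB , trace = shX R (⊆-trans R⊆A A⊆X)
  in B , FB , (begin
    B ∩ A        ≡⟨ cong (B ∩_) (trans (∩-comm X A) (⊆⇒∩≡ A⊆X)) ⟨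
    B ∩ (X ∩ A)  ≡⟨ ∩-assoc B X A ⟨
    (B ∩ X) ∩ A  ≡⟨ cong (_∩ A) trace ⟩
    R ∩ A        ≡⟨ ⊆⇒∩≡ R⊆A ⟩
    R            ∎)
  where open ≡-Reasoning

Sh-down-closed : ∀ {n} (F : Family n) {X A} → A ⊆ X → T (Sh F X) → T (Sh F A)
Sh-down-closed F {X} {A} A⊆X shX =
  shatters-complete F A (shatters-downward F A⊆X (shatters-sound F X shX))

F₀ F₁ : ∀ {n} → Family (suc n) → Family n
F₀ F A = F (outside ∷ A)
F₁ F A = F (inside ∷ A)

shatters-∪ : ∀ {n} (F : Family (suc n)) S →
  Shatters (λ A → F₀ F A ∨ F₁ F A) S → Shatters F (outside ∷ S)
shatters-∪ F S sh (inside ∷ R) R⊆S with R⊆S Vec.here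
... | ()
shatters-∪ F S sh (outside ∷ R) R⊆S with sh R (drop-∷-⊆ R⊆S)
... | A , F₀A∨F₁A , trace with F (outside ∷ A) in F₀A
... | true = outside ∷ A , subst T (sym F₀A) tt , cong (outside ∷_) trace
... | false = inside ∷ A , F₀A∨F₁A , cong (outside ∷_) trace

shatters-∩ : ∀ {n} (F : Family (suc n)) S →
  Shatters (λ A → F₀ F A ∧ F₁ F A) S → Shatters F (inside ∷ S)
shatters-∩ F S sh (b ∷ R) R⊆S =
  let A , F₀A∧F₁A , trace = sh R (drop-∷-⊆ R⊆S)
      F₀A , F₁A = to T-∧ F₀A∧F₁A
      in-F : ∀ b → T (F (b ∷ A))
      in-F = λ { outside → F₀A ; inside → F₁A }
  in b ∷ A , in-F b , cong₂ _∷_ (∧-identityʳ b) trace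

-- For n = 0 both sides compute: ∅ is
-- shattered as soon as F is nonempty.  In the step F is split along the
-- first point and F₀ + F₁ is traded for (F₀ ∪ F₁) + (F₀ ∩ F₁).
pajor-count : ∀ n (F : Family n) → count F (allSubsets n) ≤ count (Sh F) (allSubsets n)
pajor-count zero F with F []
... | false = z≤n
... | true = s≤s z≤n
pajor-count (suc n) F = begin
  count F (allSubsets (suc n))
    ≡⟨ count-allSubsets-suc F ⟩
  count (F₀ F) xs + count (F₁ F) xs
    ≡⟨ count-∨-∧ (F₀ F) (F₁ F) xs ⟨
  count F∪ xs + count F∩ xs
    ≤⟨ ℕ.+-mono-≤ (pajor-count n F∪) (pajor-count n F∩) ⟩
  count (Sh F∪) xs + count (Sh F∩) xs
    ≤⟨ ℕ.+-mono-≤ (count-mono _ _ (lift (shatters-∪ F)) xs) (count-mono _ _ (lift (shatters-∩ F)) xs) ⟩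
  count (F₀ (Sh F)) xs + count (F₁ (Sh F)) xs
    ≡⟨ count-allSubsets-suc (Sh F) ⟨
  count (Sh F) (allSubsets (suc n)) ∎
  where
  open ℕ.≤-Reasoning
  xs = allSubsets n
  F∪ F∩ : Family n
  F∪ A = F₀ F A ∨ F₁ F A
  F∩ A = F₀ F A ∧ F₁ F A
  lift : ∀ {G : Family n} {b} → (∀ S → Shatters G S → Shatters F (b ∷ S)) →
    ∀ S → T (Sh G S) → T (Sh F (b ∷ S))
  lift {G} step S shG = shatters-complete F _ (step S (shatters-sound G S shG))

pajor : ∀ {n} (F : Family n) → ∣ F ∣ᶠ ≤ ∣ Sh F ∣ᶠ
pajor {n} F = begin
  ∣ F ∣ᶠ                       ≡⟨ ∣∣ᶠ-count F ⟩
  count F (allSubsets n)       ≤⟨ pajor-count n F ⟩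
  count (Sh F) (allSubsets n)  ≡⟨ ∣∣ᶠ-count (Sh F) ⟨
  ∣ Sh F ∣ᶠ                    ∎
  where open ℕ.≤-Reasoning

_⊊ᵇ_ : ∀ {n} → Subset n → Subset n → Bool
A ⊊ᵇ B = (A ⊆ᵇ B) ∧ not (A ==ᵇ B)

⊊ᵇ-intro : ∀ {n} {A B : Subset n} → A ⊆ B → A ≢ B → T (A ⊊ᵇ B)
⊊ᵇ-intro {A = A} {B} A⊆B A≢B =
  from T-∧ (fromWitness {a? = A ⊆? B} A⊆B , fromWitnessFalse {a? = ≡-dec Bool._≟_ A B} A≢B)

⊊ᵇ-elim : ∀ {n} {A B : Subset n} → T (A ⊊ᵇ B) → A ⊆ B × A ≢ B
⊊ᵇ-elim {A = A} {B} A⊊B =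
  let A⊆B , A≢B = to (T-∧ {A ⊆ᵇ B}) A⊊B
  in toWitness {a? = A ⊆? B} A⊆B , toWitnessFalse {a? = ≡-dec Bool._≟_ A B} A≢B

minimal : ∀ {n} → Family n → Family n
minimal {n} G A = G A ∧ not (any (λ B → G B ∧ (B ⊊ᵇ A)) (allSubsets n))

minimal-member : ∀ {n} (G : Family n) {A} → T (minimal G A) → T (G A)
minimal-member G min = proj₁ (to T-∧ min)

minimal-least : ∀ {n} (G : Family n) {A B} → T (minimal G A) → T (G B) → B ⊆ A → B ≡ A
minimal-least G {A} {B} min GB B⊆A with ≡-dec Bool._≟_ B A
... | yes B≡A = B≡A
... | no B≢A =
  ⊥-elim (none-elim _ (proj₂ (to T-∧ min)) B (from T-∧ (GB , ⊊ᵇ-intro B⊆A B≢A)))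

minimal-sperner : ∀ {n} (G : Family n) → Sperner (minimal G)
minimal-sperner G A B minA minB A⊆B =
  minimal-least G (from T-≡ minB) (minimal-member G (from T-≡ minA)) A⊆B

minimal-below : ∀ {n} (G : Family n) X → T (G X) → ∃[ A ] (A ⊆ X × T (minimal G A))
minimal-below {n} G X = go X (wellFounded ∣_∣ <-wellFounded X)
  where
  go : ∀ X → Acc (_<_ on ∣_∣) X → T (G X) → ∃[ A ] (A ⊆ X × T (minimal G A))
  go X (acc smaller) GX with any (λ B → G B ∧ (B ⊊ᵇ X)) (allSubsets n) in e
  ... | false = X , ⊆-refl , from T-∧ (GX , from T-not-≡ e)
  ... | true =
    let B , GB∧B⊊X = satisfied (any⁻ _ (allSubsets n) (from T-≡ e))
        GB , B⊊X = to T-∧ GB∧B⊊X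
        B⊆X , B≢X = ⊊ᵇ-elim B⊊X
        A , A⊆B , minA = go B (smaller (⊊⇒∣∣< B⊆X B≢X)) GB
    in A , ⊆-trans A⊆B B⊆X , minA

H-minimal-complement : ∀ {n} (D : Family n) →
  (∀ {X A} → A ⊆ X → T (D X) → T (D A)) →
  ∀ X → T (D X) ⇔ T (H (minimal (λ A → not (D A))) X)
H-minimal-complement {n} D down X = mk⇔ D⇒H H⇒D
  where
  Dᶜ : Family n
  Dᶜ A = not (D A)
  D⇒H : T (D X) → T (H (minimal Dᶜ) X)
  D⇒H DX = none-intro _ λ A minA∧A⊆X →
    let minA , A⊆X = to (T-∧ {minimal Dᶜ A}) minA∧A⊆X
    in T-not-¬ (minimal-member Dᶜ minA) (down (toWitness {a? = A ⊆? X} A⊆X) DX)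
  H⇒D : T (H (minimal Dᶜ) X) → T (D X)
  H⇒D HX with D X in DX
  ... | true = tt
  ... | false =
    let A , A⊆X , minA = minimal-below Dᶜ X (from T-not-≡ DX)
    in none-elim _ HX A (from T-∧ (minA , fromWitness {a? = A ⊆? X} A⊆X))

Sh⊆H : ∀ {n} (F S : Family n) → (∀ A → T (S A) → ¬ Shatters F A) →
  ∀ X → T (Sh F X) → T (H S X)
Sh⊆H F S unshattered X shX = none-intro _ λ A SA∧A⊆X →
  let SA , A⊆X = to T-∧ SA∧A⊆X
  in unshattered A SA (shatters-downward F (toWitness {a? = A ⊆? X} A⊆X) (shatters-sound F X shX))

proposition13 : (n : ℕ) (F : Family n) →
    SExtremal F ⇔ Σ (Family n) (λ S → Sperner S × (S -Extremal F))
proposition13 n F = mk⇔ extremal⇒ ⇒extremal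
  where
  extremal⇒ : SExtremal F → Σ (Family n) (λ S → Sperner S × (S -Extremal F))
  extremal⇒ ∣Sh∣≡∣F∣ = S , minimal-sperner NotSh , unshattered , ∣F∣≡∣HS∣
    where
    NotSh : Family n
    NotSh A = not (Sh F A)
    S : Family n
    S = minimal NotSh
    unshattered : ∀ A → S A ≡ true → shatters F A ≡ false
    unshattered A SA = to T-not-≡ (minimal-member NotSh (from T-≡ SA))
    ∣F∣≡∣HS∣ : ∣ F ∣ᶠ ≡ ∣ H S ∣ᶠ
    ∣F∣≡∣HS∣ = trans (sym ∣Sh∣≡∣F∣)
      (∣∣ᶠ-cong (Sh F) (H S) (H-minimal-complement (Sh F) (Sh-down-closed F)))
  ⇒extremal : Σ (Family n) (λ S → Sperner S × (S -Extremal F)) → SExtremal F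
  ⇒extremal (S , _ , unshattered , ∣F∣≡∣HS∣) = ℕ.≤-antisym ∣Sh∣≤∣F∣ (pajor F)
    where
    unshattered′ : ∀ A → T (S A) → ¬ Shatters F A
    unshattered′ A SA shA =
      T-not-¬ (from T-not-≡ (unshattered A (to T-≡ SA))) (shatters-complete F A shA)
    ∣Sh∣≤∣F∣ : ∣ Sh F ∣ᶠ ≤ ∣ F ∣ᶠ
    ∣Sh∣≤∣F∣ = ℕ.≤-trans (∣∣ᶠ-mono (Sh F) (H S) (Sh⊆H F S unshattered′)) (ℕ.≤-reflexive (sym ∣F∣≡∣HS∣))
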